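{- Let $n\ge 1$ and let $r\ge 0$ be an integer, and let $\sigma$ be a maximal simplex of $\mathcal{N}(\mathbb{I}_n,r)$. Then if $r$ is even, there is a vertex $u\in V(\mathbb{I}_n)$ with $\sigma=N_{r/2}[u]$; and if $r$ is odd, there is an edge $(v,w)\in E(\mathbb{I}_n)$ with $\sigma=N_{(r-1)/2}[v]\cup N_{(r-1)/2}[w]$.
   Context: For a finite simple connected graph $G$ and a real number $r\ge 0$, the Čech complex $\mathcal{N}(G,r)$ is the simplicial complex with vertex set $V(G)$ in which a finite nonempty set $\sigma\subseteq V(G)$ is a simplex if and only if the closed balls of radius $\frac r2$ centered at the vertices of $\sigma$ have a common point, the balls being taken in the geometric realization of $G$ with the shortest path metric in which each edge is isometric to $[0,1]$. The hypercube graph $\mathbb{I}_n$ has vertex set $\{0,1\}^n$, two vertices adjacent iff they differ in exactly one coordinate. For a vertex $v$ and $s\ge 0$, $N_s[v]$ is the set of vertices at shortest path (Hamming) distance at most $s$ from $v$.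
   Formalization: The points of the geometric realization of $\mathbb{I}_n$, where the balls defining $\mathcal{N}(\mathbb{I}_n,r)$ must meet, lie at rational rather than real distances from the endpoints of their edges. -}

module Defs where

open import Data.Nat as ℕ using (ℕ; zero; suc)
open import Data.Bool using (Bool; true; false; not; if_then_else_)
open import Data.Fin using (Fin)
open import Data.Vec using (Vec; []; _∷_; updateAt)
open import Data.Integer using (+_)
open import Data.Rational using (ℚ; _/_; _+_; _-_; _⊓_; _≤_; 0ℚ; 1ℚ)
open import Data.Product using (Σ; ∃; _×_)
open import Relation.Binary.PropositionalEquality using (_≡_)

Vertex : ℕ → Set
Vertex n = Vec Bool n

-- Hamming distance = shortest path distance in I_n
hamming : ∀ {n} → Vertex n → Vertex n → ℕ
hamming []       []       = 0
hamming (a ∷ u) (b ∷ v) = (if a Data.Bool.xor b then 1 else 0) ℕ.+ hamming u v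

Adjacent : ∀ {n} → Vertex n → Vertex n → Set
Adjacent v w = hamming v w ≡ 1

flipAt : ∀ {n} → Vertex n → Fin n → Vertex n
flipAt v i = updateAt v i not

-- Points of the geometric realization |I_n| : the point on the edge
-- {base , flipAt base dir} at distance t ∈ [0,1] from base
-- (t = 0 gives the vertex base itself; every vertex lies on an edge when n ≥ 1).
record Point (n : ℕ) : Set where
  constructor pt
  field
    base : Vertex n
    dir  : Fin n
    t    : ℚ
    0≤t  : 0ℚ ≤ t
    t≤1  : t ≤ 1ℚ
open Point public

ℕtoℚ : ℕ → ℚ
ℕtoℚ m = + m / 1

-- shortest path distance in |I_n| (each edge isometric to [0,1]) from a vertex
-- to a point: go to one of the two endpoints of the edge, then along it.
dist : ∀ {n} → Vertex n → Point n → ℚ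
dist u p = (ℕtoℚ (hamming u (base p)) + t p)
         ⊓ (ℕtoℚ (hamming u (flipAt (base p) (dir p))) + (1ℚ - t p))

VSet : ℕ → Set
VSet n = Vertex n → Bool

_∈ˢ_ : ∀ {n} → Vertex n → VSet n → Set
x ∈ˢ σ = σ x ≡ true

_⊆ˢ_ : ∀ {n} → VSet n → VSet n → Set
σ ⊆ˢ τ = ∀ x → x ∈ˢ σ → x ∈ˢ τ

IsCechSimplex : ∀ {n} → ℕ → VSet n → Set
IsCechSimplex {n} r σ =
  (∃ λ x → x ∈ˢ σ) × (Σ (Point n) λ p → ∀ x → x ∈ˢ σ → dist x p ≤ (+ r / 2))

IsMaximalCechSimplex : ∀ {n} → ℕ → VSet n → Set
IsMaximalCechSimplex {n} r σ =
  IsCechSimplex r σ × (∀ (τ : VSet n) → IsCechSimplex r τ → σ ⊆ˢ τ → τ ⊆ˢ σ)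

_∈N[_,_] : ∀ {n} → Vertex n → ℕ → Vertex n → Set
x ∈N[ s , v ] = hamming v x ℕ.≤ s

{-# OPTIONS --safe #-}
module Submission where

-- The witness point p of a Čech simplex lies on an edge {b, b′} at distance t from b, so a
-- vertex x is within r/2 of p iff h(b,x) + t ≤ r/2 or h(b′,x) + (1 − t) ≤ r/2, with h the
-- Hamming distance. For r = 2k + 1 this places x in N_k[b] ∪ N_k[b′]. For r = 2k, a vertex
-- that is close to p through the endpoint reached with positive slack (b′ if t < 1, else b)
-- is at distance < k from it, hence ≤ k from the other endpoint, so σ lies in a single ball
-- N_k. Conversely N_k[c] (witnessed by the vertex c) and N_k[b] ∪ N_k[b′] (witnessed by the
-- midpoint of the edge) are simplices, so maximality turns these inclusions into equalities.

open import Defs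
open import Data.Nat using (ℕ; _≤_; _+_; _*_)
open import Data.Product using (Σ; _×_)
open import Data.Sum using (_⊎_)
open import Function.Bundles using (_⇔_)
open import Relation.Binary.PropositionalEquality using (_≡_)

open import Data.Bool using (Bool; true; false; _∨_; _xor_; if_then_else_)
open import Data.Bool.Properties using (T-≡)
open import Data.Fin as Fin using (Fin)
open import Data.Integer as ℤ using (+_)
import Data.Integer.Properties as ℤ
open import Data.Nat as ℕ using (suc; z≤n; s≤s; _≤ᵇ_)
open import Data.Nat.Properties as ℕ using (module ≤-Reasoning)
open import Data.Product using (_,_)
open import Data.Rational as ℚ using (ℚ; _/_; 0ℚ; 1ℚ; toℚᵘ)
import Data.Rational.Properties as ℚ
open import Data.Rational.Unnormalised as ℚᵘ using (mkℚᵘ; *≤*)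
import Data.Rational.Unnormalised.Properties as ℚᵘ
open import Data.Sum as Sum using (inj₁; inj₂; [_,_]; [_,_]′)
open import Data.Sum.Function.Propositional using (_⊎-⇔_)
open import Data.Vec using ([]; _∷_)
open import Function.Base using (id; _∘_)
open import Function.Bundles using (Equivalence; mk⇔)
open import Function.Construct.Composition using (_⇔-∘_)
open import Relation.Binary.PropositionalEquality
  using (refl; sym; trans; cong; cong₂; subst; module ≡-Reasoning)
open import Relation.Nullary using (yes; no)

open Equivalence using (to; from)
open import Algebra.Properties.CommutativeSemigroup ℕ.+-commutativeSemigroup using (interchange)

bitDistance : Bool → Bool → ℕ
bitDistance a b = if a xor b then 1 else 0

bitDistance-triangle : ∀ a b c → bitDistance a c ≤ bitDistance a b + bitDistance b c
bitDistance-triangle true  _     true  = z≤n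
bitDistance-triangle false _     false = z≤n
bitDistance-triangle true  true  false = s≤s z≤n
bitDistance-triangle true  false false = s≤s z≤n
bitDistance-triangle false true  true  = s≤s z≤n
bitDistance-triangle false false true  = s≤s z≤n

hamming-triangle : ∀ {n} (u v w : Vertex n) → hamming u w ≤ hamming u v + hamming v w
hamming-triangle []      []      []      = z≤n
hamming-triangle (a ∷ u) (b ∷ v) (c ∷ w) = begin
  bitDistance a c + hamming u w
    ≤⟨ ℕ.+-mono-≤ (bitDistance-triangle a b c) (hamming-triangle u v w) ⟩
  (bitDistance a b + bitDistance b c) + (hamming u v + hamming v w)
    ≡⟨ interchange (bitDistance a b) (bitDistance b c) (hamming u v) (hamming v w) ⟩
  (bitDistance a b + hamming u v) + (bitDistance b c + hamming v w) ∎
  where open ≤-Reasoning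

hamming-sym : ∀ {n} (u v : Vertex n) → hamming u v ≡ hamming v u
hamming-sym []          []          = refl
hamming-sym (true ∷ u)  (true ∷ v)  = hamming-sym u v
hamming-sym (true ∷ u)  (false ∷ v) = cong suc (hamming-sym u v)
hamming-sym (false ∷ u) (true ∷ v)  = cong suc (hamming-sym u v)
hamming-sym (false ∷ u) (false ∷ v) = hamming-sym u v

hamming-self : ∀ {n} (v : Vertex n) → hamming v v ≡ 0
hamming-self []          = refl
hamming-self (true ∷ v)  = hamming-self v
hamming-self (false ∷ v) = hamming-self v

flipAt-adjacent : ∀ {n} (v : Vertex n) (i : Fin n) → Adjacent v (flipAt v i)
flipAt-adjacent (true ∷ v)  Fin.zero    = cong suc (hamming-self v)
flipAt-adjacent (false ∷ v) Fin.zero    = cong suc (hamming-self v)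
flipAt-adjacent (true ∷ v)  (Fin.suc i) = flipAt-adjacent v i
flipAt-adjacent (false ∷ v) (Fin.suc i) = flipAt-adjacent v i

adjacent-sym : ∀ {n} {v w : Vertex n} → Adjacent v w → Adjacent w v
adjacent-sym {v = v} {w} = trans (hamming-sym w v)

adjacent⇒hamming-≤-suc : ∀ {n} {v w : Vertex n} → Adjacent v w →
                         ∀ x → hamming v x ≤ suc (hamming w x)
adjacent⇒hamming-≤-suc {v = v} {w} v~w x =
  subst (λ d → hamming v x ≤ d + hamming w x) v~w (hamming-triangle v w x)

2*m≤2*n+1⇒m≤n : ∀ {m n} → 2 * m ≤ 2 * n + 1 → m ≤ n
2*m≤2*n+1⇒m≤n {m} {n} le = ℕ.m<1+n⇒m≤n (ℕ.*-cancelˡ-< 2 m (suc n) (begin-strict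
  2 * m         ≤⟨ le ⟩
  2 * n + 1     ≡⟨ ℕ.+-comm (2 * n) 1 ⟩
  suc (2 * n)   <⟨ ℕ.n<1+n (suc (2 * n)) ⟩
  2 + 2 * n     ≡⟨ ℕ.*-suc 2 n ⟨
  2 * suc n     ∎))
  where open ≤-Reasoning

half : ℕ → ℚ
half m = + m / 2

toℚᵘ-/ : ∀ i d → toℚᵘ (i / suc d) ℚᵘ.≃ mkℚᵘ i d
toℚᵘ-/ i d = ℚ.toℚᵘ-fromℚᵘ (mkℚᵘ i d)

half-mono-≤ : ∀ {a b} → a ≤ b → half a ℚ.≤ half b
half-mono-≤ {a} {b} a≤b = ℚ.toℚᵘ-cancel-≤
  (ℚᵘ.≤-respˡ-≃ (ℚᵘ.≃-sym (toℚᵘ-/ (+ a) 1))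
    (ℚᵘ.≤-respʳ-≃ (ℚᵘ.≃-sym (toℚᵘ-/ (+ b) 1)) unnormalised))
  where
  unnormalised : mkℚᵘ (+ a) 1 ℚᵘ.≤ mkℚᵘ (+ b) 1
  unnormalised = *≤* (ℤ.*-monoʳ-≤-nonNeg (+ 2) (ℤ.+≤+ a≤b))

half-cancel-≤ : ∀ {a b} → half a ℚ.≤ half b → a ≤ b
half-cancel-≤ {a} {b} le =
  ℤ.drop‿+≤+ (ℤ.*-cancelʳ-≤-pos (+ a) (+ b) (+ 2) (ℚᵘ.drop-*≤* unnormalised))
  where
  unnormalised : mkℚᵘ (+ a) 1 ℚᵘ.≤ mkℚᵘ (+ b) 1
  unnormalised =
    ℚᵘ.≤-respˡ-≃ (toℚᵘ-/ (+ a) 1) (ℚᵘ.≤-respʳ-≃ (toℚᵘ-/ (+ b) 1) (ℚ.toℚᵘ-mono-≤ le))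

half-cancel-< : ∀ {a b} → half a ℚ.< half b → a ℕ.< b
half-cancel-< {a} {b} lt =
  ℤ.drop‿+<+ (ℤ.*-cancelʳ-<-nonNeg (+ 2) (ℚᵘ.drop-*<* unnormalised))
  where
  unnormalised : mkℚᵘ (+ a) 1 ℚᵘ.< mkℚᵘ (+ b) 1
  unnormalised =
    ℚᵘ.<-respˡ-≃ (toℚᵘ-/ (+ a) 1) (ℚᵘ.<-respʳ-≃ (toℚᵘ-/ (+ b) 1) (ℚ.toℚᵘ-mono-< lt))

ℕtoℚ-+-half : ∀ h a → ℕtoℚ h ℚ.+ half a ≡ half (2 * h + a)
ℕtoℚ-+-half h a = ℚ.toℚᵘ-injective (begin
  toℚᵘ (ℕtoℚ h ℚ.+ half a)
    ≈⟨ ℚ.toℚᵘ-homo-+ (ℕtoℚ h) (half a) ⟩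
  toℚᵘ (ℕtoℚ h) ℚᵘ.+ toℚᵘ (half a)
    ≈⟨ ℚᵘ.+-cong (toℚᵘ-/ (+ h) 0) (toℚᵘ-/ (+ a) 1) ⟩
  mkℚᵘ (+ h ℤ.* + 2 ℤ.+ + a ℤ.* + 1) 1
    ≡⟨ cong (λ i → mkℚᵘ i 1) numerator ⟩
  mkℚᵘ (+ (2 * h + a)) 1
    ≈⟨ toℚᵘ-/ (+ (2 * h + a)) 1 ⟨
  toℚᵘ (half (2 * h + a)) ∎)
  where
  open ℚᵘ.≃-Reasoning
  numerator : + h ℤ.* + 2 ℤ.+ + a ℤ.* + 1 ≡ + (2 * h + a)
  numerator = trans (cong₂ ℤ._+_ (sym (ℤ.pos-* h 2)) (sym (ℤ.pos-* a 1)))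
                    (cong +_ (cong₂ _+_ (ℕ.*-comm h 2) (ℕ.*-identityʳ a)))

ℕtoℚ≡half : ∀ h → ℕtoℚ h ≡ half (2 * h)
ℕtoℚ≡half h = begin
  ℕtoℚ h                ≡⟨ ℚ.+-identityʳ (ℕtoℚ h) ⟨
  ℕtoℚ h ℚ.+ half 0     ≡⟨ ℕtoℚ-+-half h 0 ⟩
  half (2 * h + 0)      ≡⟨ cong half (ℕ.+-identityʳ (2 * h)) ⟩
  half (2 * h)          ∎
  where open ≡-Reasoning

p≤p+q : ∀ {p q} → 0ℚ ℚ.≤ q → p ℚ.≤ p ℚ.+ q
p≤p+q {p} 0≤q = subst (ℚ._≤ p ℚ.+ _) (ℚ.+-identityʳ p) (ℚ.+-monoʳ-≤ p 0≤q)

p<p+q : ∀ {p q} → 0ℚ ℚ.< q → p ℚ.< p ℚ.+ q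
p<p+q {p} 0<q = subst (ℚ._< p ℚ.+ _) (ℚ.+-identityʳ p) (ℚ.+-monoʳ-< p 0<q)

ℕtoℚ+nonNeg≤half⇒≤ : ∀ h m {s} → 0ℚ ℚ.≤ s → ℕtoℚ h ℚ.+ s ℚ.≤ half m → 2 * h ≤ m
ℕtoℚ+nonNeg≤half⇒≤ h m 0≤s le =
  half-cancel-≤ (subst (ℚ._≤ _) (ℕtoℚ≡half h) (ℚ.≤-trans (p≤p+q 0≤s) le))

ℕtoℚ+pos≤half⇒< : ∀ h m {s} → 0ℚ ℚ.< s → ℕtoℚ h ℚ.+ s ℚ.≤ half m → 2 * h ℕ.< m
ℕtoℚ+pos≤half⇒< h m 0<s le =
  half-cancel-< (subst (ℚ._< _) (ℕtoℚ≡half h) (ℚ.<-≤-trans (p<p+q 0<s) le))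

ℕtoℚ+half≤half : ∀ h a {m} → 2 * h + a ≤ m → ℕtoℚ h ℚ.+ half a ℚ.≤ half m
ℕtoℚ+half≤half h a le = subst (ℚ._≤ _) (sym (ℕtoℚ-+-half h a)) (half-mono-≤ le)

0≤1-t : ∀ {t} → t ℚ.≤ 1ℚ → 0ℚ ℚ.≤ 1ℚ ℚ.- t
0≤1-t {t} t≤1 = subst (ℚ._≤ 1ℚ ℚ.- t) (ℚ.+-inverseʳ t) (ℚ.+-monoˡ-≤ (ℚ.- t) t≤1)

0<t⊎0<1-t : ∀ t → 0ℚ ℚ.< t ⊎ 0ℚ ℚ.< 1ℚ ℚ.- t
0<t⊎0<1-t t with t ℚ.<? 1ℚ
... | yes t<1 =
  inj₂ (subst (ℚ._< 1ℚ ℚ.- t) (ℚ.+-inverseʳ t) (ℚ.+-monoˡ-< (ℚ.- t) t<1))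
... | no  t≮1 = inj₁ (ℚ.<-≤-trans (ℚ.*<* (ℤ.+<+ (s≤s z≤n))) (ℚ.≮⇒≥ t≮1))

p⊓q≤r⇒p≤r⊎q≤r : ∀ {p q r} → p ℚ.⊓ q ℚ.≤ r → p ℚ.≤ r ⊎ q ℚ.≤ r
p⊓q≤r⇒p≤r⊎q≤r {p} {q} {r} le = Sum.map at at (ℚ.⊓-sel p q)
  where
  at : ∀ {s} → p ℚ.⊓ q ≡ s → s ℚ.≤ r
  at eq = subst (ℚ._≤ r) eq le

distViaBase distViaFlip : ∀ {n} → Vertex n → Point n → ℚ
distViaBase x p = ℕtoℚ (hamming (base p) x) ℚ.+ t p
distViaFlip x p = ℕtoℚ (hamming (flipAt (base p) (dir p)) x) ℚ.+ (1ℚ ℚ.- t p)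

dist≡distViaBase⊓distViaFlip : ∀ {n} (x : Vertex n) p →
                               dist x p ≡ distViaBase x p ℚ.⊓ distViaFlip x p
dist≡distViaBase⊓distViaFlip x p =
  cong₂ (λ h h′ → (ℕtoℚ h ℚ.+ t p) ℚ.⊓ (ℕtoℚ h′ ℚ.+ (1ℚ ℚ.- t p)))
  (hamming-sym x (base p)) (hamming-sym x (flipAt (base p) (dir p)))

dist≤distViaBase : ∀ {n} (x : Vertex n) p → dist x p ℚ.≤ distViaBase x p
dist≤distViaBase x p = ℚ.≤-trans (ℚ.≤-reflexive (dist≡distViaBase⊓distViaFlip x p))
  (ℚ.p⊓q≤p (distViaBase x p) (distViaFlip x p))

dist≤distViaFlip : ∀ {n} (x : Vertex n) p → dist x p ℚ.≤ distViaFlip x p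
dist≤distViaFlip x p = ℚ.≤-trans (ℚ.≤-reflexive (dist≡distViaBase⊓distViaFlip x p))
  (ℚ.p⊓q≤q (distViaBase x p) (distViaFlip x p))

dist≤⇒ : ∀ {n} (x : Vertex n) p {q} → dist x p ℚ.≤ q →
         distViaBase x p ℚ.≤ q ⊎ distViaFlip x p ℚ.≤ q
dist≤⇒ x p {q} le =
  p⊓q≤r⇒p≤r⊎q≤r (subst (ℚ._≤ q) (dist≡distViaBase⊓distViaFlip x p) le)

-- Opaque, so that the implicit arguments of ∈-ball and ∈-∪ˢ are inferable from a membership proof.
opaque
  ball : ∀ {n} → Vertex n → ℕ → VSet n
  ball c k x = hamming c x ≤ᵇ k

  ∈-ball : ∀ {n} {c x : Vertex n} {k} → x ∈ˢ ball c k ⇔ x ∈N[ k , c ]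
  ∈-ball = mk⇔ (ℕ.≤ᵇ⇒≤ _ _ ∘ from T-≡) (to T-≡ ∘ ℕ.≤⇒≤ᵇ)

  _∪ˢ_ : ∀ {n} → VSet n → VSet n → VSet n
  (σ ∪ˢ τ) x = σ x ∨ τ x

  ∈-∪ˢ : ∀ {n} {σ τ : VSet n} {x} → x ∈ˢ (σ ∪ˢ τ) ⇔ (x ∈ˢ σ ⊎ x ∈ˢ τ)
  ∈-∪ˢ {σ = σ} {x = x} with σ x
  ... | true  = mk⇔ (λ _ → inj₁ refl) (λ _ → refl)
  ... | false = mk⇔ inj₂ [ (λ ()) , id ]

_≐ˢ_ : ∀ {n} → VSet n → VSet n → Set
σ ≐ˢ τ = ∀ x → x ∈ˢ σ ⇔ x ∈ˢ τ

centre∈ball : ∀ {n} (c : Vertex n) k → c ∈ˢ ball c k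
centre∈ball c k = from ∈-ball (subst (_≤ k) (sym (hamming-self c)) z≤n)

maximal-⊆⇒≐ˢ : ∀ {n r} {σ τ : VSet n} → IsMaximalCechSimplex r σ → IsCechSimplex r τ →
               σ ⊆ˢ τ → σ ≐ˢ τ
maximal-⊆⇒≐ˢ (_ , maximal) τ-simplex σ⊆τ x = mk⇔ (σ⊆τ x) (maximal _ τ-simplex σ⊆τ x)

ball-isCechSimplex : ∀ {n} (c : Vertex n) k (i : Fin n) → IsCechSimplex (2 * k) (ball c k)
ball-isCechSimplex c k i =
  (c , centre∈ball c k) ,
  (centre , λ x x∈ball → ℚ.≤-trans (dist≤distViaBase x centre) (close x (to ∈-ball x∈ball)))
  where
  centre : Point _
  centre = pt c i (half 0) ℚ.≤-refl (ℚ.*≤* (ℤ.+≤+ z≤n))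
  close : ∀ x → x ∈N[ k , c ] → ℕtoℚ (hamming c x) ℚ.+ half 0 ℚ.≤ half (2 * k)
  close x h≤k = ℕtoℚ+half≤half (hamming c x) 0
    (ℕ.≤-trans (ℕ.≤-reflexive (ℕ.+-identityʳ (2 * hamming c x))) (ℕ.*-monoʳ-≤ 2 h≤k))

edge-isCechSimplex : ∀ {n} (b : Vertex n) (i : Fin n) k →
                     IsCechSimplex (2 * k + 1) (ball b k ∪ˢ ball (flipAt b i) k)
edge-isCechSimplex b i k =
  (b , from ∈-∪ˢ (inj₁ (centre∈ball b k))) ,
  (midpoint , λ x → [ ℚ.≤-trans (dist≤distViaBase x midpoint) ∘ close b x
                    , ℚ.≤-trans (dist≤distViaFlip x midpoint) ∘ close (flipAt b i) x
                    ]′ ∘ to ∈-∪ˢ)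
  where
  -- 1ℚ ℚ.- half 1 reduces to half 1, so both endpoints are reached with slack half 1.
  midpoint : Point _
  midpoint = pt b i (half 1) (ℚ.*≤* (ℤ.+≤+ z≤n)) (ℚ.*≤* (ℤ.+≤+ (s≤s z≤n)))
  close : ∀ c x → x ∈ˢ ball c k → ℕtoℚ (hamming c x) ℚ.+ half 1 ℚ.≤ half (2 * k + 1)
  close c x x∈ball = ℕtoℚ+half≤half (hamming c x) 1
    (ℕ.+-monoˡ-≤ 1 (ℕ.*-monoʳ-≤ 2 (to ∈-ball x∈ball)))

via-endpoints≤k⇒∈N : ∀ {n} (c c′ x : Vertex n) k {s s′} → Adjacent c c′ →
  0ℚ ℚ.≤ s → 0ℚ ℚ.< s′ →
  ℕtoℚ (hamming c x) ℚ.+ s ℚ.≤ half (2 * k) ⊎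
  ℕtoℚ (hamming c′ x) ℚ.+ s′ ℚ.≤ half (2 * k) →
  x ∈N[ k , c ]
via-endpoints≤k⇒∈N c _ x k _ 0≤s _ (inj₁ near) =
  ℕ.*-cancelˡ-≤ 2 (ℕtoℚ+nonNeg≤half⇒≤ (hamming c x) (2 * k) 0≤s near)
via-endpoints≤k⇒∈N c c′ x k c~c′ _ 0<s′ (inj₂ near) =
  ℕ.≤-trans (adjacent⇒hamming-≤-suc {v = c} {c′} c~c′ x)
            (ℕ.*-cancelˡ-< 2 _ _ (ℕtoℚ+pos≤half⇒< (hamming c′ x) (2 * k) 0<s′ near))

via-endpoint≤k+½⇒∈N : ∀ {n} (c x : Vertex n) k {s} → 0ℚ ℚ.≤ s →
  ℕtoℚ (hamming c x) ℚ.+ s ℚ.≤ half (2 * k + 1) → x ∈N[ k , c ]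
via-endpoint≤k+½⇒∈N c x k 0≤s near =
  2*m≤2*n+1⇒m≤n (ℕtoℚ+nonNeg≤half⇒≤ (hamming c x) (2 * k + 1) 0≤s near)

maximal-even : ∀ {n} k {σ : VSet n} → IsMaximalCechSimplex (2 * k) σ →
               Σ (Vertex n) λ u → ∀ x → x ∈ˢ σ ⇔ x ∈N[ k , u ]
maximal-even k {σ} σ-maximal@((_ , point@(pt b i t 0≤t t≤1) , near) , _) =
  [ (λ 0<t   → flipAt b i , σ≐ball (σ⊆flip-ball 0<t))
  , (λ 0<1-t → b , σ≐ball (σ⊆base-ball 0<1-t))
  ]′ (0<t⊎0<1-t t)
  where
  σ≐ball : ∀ {c} → σ ⊆ˢ ball c k → ∀ x → x ∈ˢ σ ⇔ x ∈N[ k , c ]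
  σ≐ball {c} σ⊆ball x =
    ∈-ball ⇔-∘ maximal-⊆⇒≐ˢ {r = 2 * k} σ-maximal (ball-isCechSimplex c k i) σ⊆ball x
  σ⊆base-ball : 0ℚ ℚ.< 1ℚ ℚ.- t → σ ⊆ˢ ball b k
  σ⊆base-ball 0<1-t y y∈σ = from ∈-ball
    (via-endpoints≤k⇒∈N b (flipAt b i) y k (flipAt-adjacent b i) 0≤t 0<1-t
      (dist≤⇒ y point (near y y∈σ)))
  σ⊆flip-ball : 0ℚ ℚ.< t → σ ⊆ˢ ball (flipAt b i) k
  σ⊆flip-ball 0<t y y∈σ = from ∈-ball
    (via-endpoints≤k⇒∈N (flipAt b i) b y k (adjacent-sym {v = b} (flipAt-adjacent b i))
      (0≤1-t t≤1) 0<t (Sum.swap (dist≤⇒ y point (near y y∈σ))))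

maximal-odd : ∀ {n} k {σ : VSet n} → IsMaximalCechSimplex (2 * k + 1) σ →
  Σ (Vertex n) λ v → Σ (Vertex n) λ w → Adjacent v w ×
    (∀ x → x ∈ˢ σ ⇔ (x ∈N[ k , v ] ⊎ x ∈N[ k , w ]))
maximal-odd k {σ} σ-maximal@((_ , point@(pt b i t 0≤t t≤1) , near) , _) =
  b , flipAt b i , flipAt-adjacent b i , λ x →
    (∈-ball ⊎-⇔ ∈-ball) ⇔-∘
    (∈-∪ˢ ⇔-∘ maximal-⊆⇒≐ˢ {r = 2 * k + 1} σ-maximal (edge-isCechSimplex b i k) σ⊆edge x)
  where
  σ⊆edge : σ ⊆ˢ (ball b k ∪ˢ ball (flipAt b i) k)
  σ⊆edge y y∈σ = from ∈-∪ˢ (Sum.map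
    (from ∈-ball ∘ via-endpoint≤k+½⇒∈N b y k 0≤t)
    (from ∈-ball ∘ via-endpoint≤k+½⇒∈N (flipAt b i) y k (0≤1-t t≤1))
    (dist≤⇒ y point (near y y∈σ)))

lemma3p1 : (n : ℕ) → 1 ≤ n → (r : ℕ) → (σ : VSet n) → IsMaximalCechSimplex r σ →
    ((k : ℕ) → r ≡ 2 * k →
      Σ (Vertex n) λ u → ∀ x → (x ∈ˢ σ) ⇔ (x ∈N[ k , u ]))
    × ((k : ℕ) → r ≡ 2 * k + 1 →
      Σ (Vertex n) λ v → Σ (Vertex n) λ w → Adjacent v w ×
        (∀ x → (x ∈ˢ σ) ⇔ ((x ∈N[ k , v ]) ⊎ (x ∈N[ k , w ]))))
-- The hypothesis 1 ≤ n is implied: the witness point of σ carries a direction in Fin n.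
lemma3p1 n _ r σ σ-maximal =
  (λ k r≡2k   → maximal-even k (subst (λ r → IsMaximalCechSimplex r σ) r≡2k σ-maximal)) ,
  (λ k r≡2k+1 → maximal-odd k (subst (λ r → IsMaximalCechSimplex r σ) r≡2k+1 σ-maximal))
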